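{- For every label~$x$, and any nested sequents $X$ and~$Y$: $\mathfrak{L}_{x}(X,\circ \{Y\})\cong \mathfrak{L}_{x}(\bullet \{X\},Y)$.
   Context: Tense formulae: $A ::= p \mid \overline{p} \mid A\wedge A \mid A\vee A \mid \Box A \mid \Diamond A \mid \blacksquare A \mid \Diamond^{ - }A$, with $\Diamond^{ - }$ the past diamond. Nested sequents: $X ::= \varepsilon \mid A \mid X,X \mid \circ\{X\} \mid \bullet\{X\}$. A labeled graph $(V,E,L)$ is a directed graph with a labeling $L$ mapping vertices to multisets of formulae; two labeled graphs are isomorphic ($\cong$) if there is a bijection on vertices preserving edges (in both directions) and labels. The map $\mathfrak{L}_x$ from nested sequents to labeled graphs (labeled polytrees) is defined by: $\mathfrak{L}_{x}(\varepsilon) = (\emptyset, \emptyset, \emptyset)$; $\mathfrak{L}_{x}(A) = (\{x\},\emptyset,\{(x,A)\})$; $\mathfrak{L}_{x}(X_1,X_2) = (V_1 \cup V_2, E_1 \cup E_2, L_1 \cup L_2)$ where $\mathfrak{L}_{x}(X_{i}) = (V_i,E_i,L_i)$ and $(L_1\cup L_2)(x)$ is the multiset union on shared vertices; $\mathfrak{L}_{x}(\circ\{X\}) = (V \cup \{x\}, E \cup \{(x,y)\}, L)$ and $\mathfrak{L}_{x}(\bullet\{X\}) = (V \cup \{x\}, E \cup \{(y,x)\}, L)$, where $\mathfrak{L}_{y}(X) = (V,E,L)$ and $y$ is fresh. -}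

module Defs where

open import Data.Nat using (ℕ; _≟_)
open import Data.List using (List; []; _∷_; _++_)
open import Data.Product using (_×_; _,_)
open import Data.Sum using (_⊎_)
open import Data.Empty using (⊥)
open import Data.Bool using (if_then_else_)
open import Relation.Nullary using (¬_)
open import Relation.Nullary.Decidable using (⌊_⌋)
open import Relation.Binary.PropositionalEquality using (_≡_)
open import Data.List.Relation.Binary.Permutation.Propositional using (_↭_)

Atom : Set
Atom = ℕ

Label : Set
Label = ℕ

data Formula : Set where
  pos   : Atom → Formula
  neg   : Atom → Formula
  _∧_   : Formula → Formula → Formula
  _∨_   : Formula → Formula → Formula
  □_    : Formula → Formula              -- future box
  ◇_    : Formula → Formula              -- future diamond
  ■_    : Formula → Formula              -- past box
  ◆_    : Formula → Formula              -- past diamond ◇⁻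

data NSeq : Set where
  ε    : NSeq
  fml  : Formula → NSeq
  _,,_ : NSeq → NSeq → NSeq
  ∘[_] : NSeq → NSeq
  •[_] : NSeq → NSeq

-- Labeled graphs: vertex set and edge relation as predicates on labels,
-- labeling as a function to multisets (lists up to permutation).
record LGraph : Set₁ where
  constructor lgraph
  field
    V : Label → Set
    E : Label → Label → Set
    L : Label → List Formula

open LGraph public

emptyG : LGraph
emptyG = lgraph (λ _ → ⊥) (λ _ _ → ⊥) (λ _ → [])

singleG : Label → Formula → LGraph
singleG x A = lgraph (λ v → v ≡ x) (λ _ _ → ⊥) (λ v → if ⌊ v ≟ x ⌋ then A ∷ [] else [])

unionG : LGraph → LGraph → LGraph
unionG G H = lgraph (λ v → V G v ⊎ V H v) (λ u v → E G u v ⊎ E H u v) (λ v → L G v ++ L H v)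

-- adding vertices x and y (y is the root of the inner graph) and the edge (a , b)
addEdge : Label → Label → Label → Label → LGraph → LGraph
addEdge x y a b G =
  lgraph (λ v → V G v ⊎ (v ≡ x ⊎ v ≡ y)) (λ u v → E G u v ⊎ (u ≡ a × v ≡ b)) (L G)

-- Rep x X G : "G is a value of 𝔏_x(X)" for some choice of fresh labels.
data Rep : Label → NSeq → LGraph → Set₁ where
  rep-ε   : ∀ {x} → Rep x ε emptyG
  rep-fml : ∀ {x A} → Rep x (fml A) (singleG x A)
  rep-,,  : ∀ {x X₁ X₂ G₁ G₂} → Rep x X₁ G₁ → Rep x X₂ G₂ →
            (∀ v → V G₁ v → V G₂ v → v ≡ x) →
            Rep x (X₁ ,, X₂) (unionG G₁ G₂)
  rep-∘   : ∀ {x y X G} → Rep y X G → ¬ (y ≡ x) → ¬ V G x →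
            Rep x (∘[ X ]) (addEdge x y x y G)
  rep-•   : ∀ {x y X G} → Rep y X G → ¬ (y ≡ x) → ¬ V G x →
            Rep x (•[ X ]) (addEdge x y y x G)

record _≅_ (G H : LGraph) : Set where
  field
    f      : Label → Label
    g      : Label → Label
    f-V    : ∀ v → V G v → V H (f v)
    g-V    : ∀ w → V H w → V G (g w)
    gf     : ∀ v → V G v → g (f v) ≡ v
    fg     : ∀ w → V H w → f (g w) ≡ w
    E-pres : ∀ u v → V G u → V G v → E G u v → E H (f u) (f v)
    E-refl : ∀ u v → V G u → V G v → E H (f u) (f v) → E G u v
    L-pres : ∀ v → V G v → L G v ↭ L H (f v)

-- Fresh labels are an arbitrary choice, so two representations of the same nested
-- sequent are isomorphic by a map sending root to root. The graph of •{X},Y at x,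
-- rooted instead at the fresh label z chosen for X, is up to regrouping of its
-- components a representation of X,∘{Y} at z; hence it is isomorphic to the graph
-- of X,∘{Y} at x.
module Submission where

open import Defs
open import Data.Nat using (_≟_)
open import Data.Bool using (if_then_else_)
open import Data.List using ([]; _∷_; _++_)
open import Data.Product using (Σ; _×_; _,_; proj₁; proj₂)
open import Data.Sum using (_⊎_; inj₁; inj₂; swap; map₂)
open import Data.Empty using (⊥-elim)
open import Function using (_∘_)
open import Relation.Nullary using (¬_; Dec; yes; no; does)
open import Relation.Nullary.Decidable using (_⊎-dec_)
open import Relation.Binary.PropositionalEquality using (_≡_; _≢_; refl; sym; trans; cong; cong₂; subst; subst₂)
open import Data.List.Relation.Binary.Permutation.Propositional using (_↭_; ↭-refl; ↭-sym; ↭-trans; ↭-reflexive)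
open import Data.List.Relation.Binary.Permutation.Propositional.Properties using (++⁺)

if-does : ∀ {P : Set} (d : Dec P) {a b c : Label} →
          (P → a ≡ c) → (¬ P → b ≡ c) → (if does d then a else b) ≡ c
if-does (yes p) a≡c _ = a≡c p
if-does (no ¬p) _ b≡c = b≡c ¬p

-- Since vertex sets are predicates, the union of two isomorphisms must decide which
-- component a vertex lies in, and labels outside the vertex set must not interfere.
record WellFormed (G : LGraph) : Set where
  field
    V?        : ∀ v → Dec (V G v)
    E⇒V       : ∀ {u v} → E G u v → V G u × V G v
    L-outside : ∀ {v} → ¬ V G v → L G v ≡ []
open WellFormed

emptyG-wellFormed : WellFormed emptyG
emptyG-wellFormed = record { V? = λ _ → no λ () ; E⇒V = λ () ; L-outside = λ _ → refl }

singleG-wellFormed : ∀ x A → WellFormed (singleG x A)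
singleG-wellFormed x A = record { V? = _≟ x ; E⇒V = λ () ; L-outside = outside }
  where
  outside : ∀ {v} → v ≢ x → L (singleG x A) v ≡ []
  outside {v} v≢x with v ≟ x
  ... | yes v≡x = ⊥-elim (v≢x v≡x)
  ... | no _    = refl

unionG-wellFormed : ∀ {G H} → WellFormed G → WellFormed H → WellFormed (unionG G H)
unionG-wellFormed wfG wfH = record
  { V?        = λ v → V? wfG v ⊎-dec V? wfH v
  ; E⇒V       = λ { (inj₁ e) → inj₁ (proj₁ (E⇒V wfG e)) , inj₁ (proj₂ (E⇒V wfG e))
                  ; (inj₂ e) → inj₂ (proj₁ (E⇒V wfH e)) , inj₂ (proj₂ (E⇒V wfH e)) }
  ; L-outside = λ ¬v → cong₂ _++_ (L-outside wfG (¬v ∘ inj₁)) (L-outside wfH (¬v ∘ inj₂)) }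

addEdge-wellFormed : ∀ {G x y a b} → (a ≡ x ⊎ a ≡ y) → (b ≡ x ⊎ b ≡ y) →
                     WellFormed G → WellFormed (addEdge x y a b G)
addEdge-wellFormed {x = x} {y} a∈xy b∈xy wfG = record
  { V?        = λ v → V? wfG v ⊎-dec (v ≟ x ⊎-dec v ≟ y)
  ; E⇒V       = λ { (inj₁ e) → inj₁ (proj₁ (E⇒V wfG e)) , inj₁ (proj₂ (E⇒V wfG e))
                  ; (inj₂ (refl , refl)) → inj₂ a∈xy , inj₂ b∈xy }
  ; L-outside = λ ¬v → L-outside wfG (¬v ∘ inj₁) }

Rep⇒wellFormed : ∀ {x X G} → Rep x X G → WellFormed G
Rep⇒wellFormed rep-ε               = emptyG-wellFormed
Rep⇒wellFormed (rep-fml {x} {A})   = singleG-wellFormed x A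
Rep⇒wellFormed (rep-,, r₁ r₂ _)    = unionG-wellFormed (Rep⇒wellFormed r₁) (Rep⇒wellFormed r₂)
Rep⇒wellFormed (rep-∘ r _ _)       = addEdge-wellFormed (inj₁ refl) (inj₂ refl) (Rep⇒wellFormed r)
Rep⇒wellFormed (rep-• r _ _)       = addEdge-wellFormed (inj₂ refl) (inj₁ refl) (Rep⇒wellFormed r)

arcG : Label → Label → LGraph
arcG s t = lgraph (λ v → v ≡ s ⊎ v ≡ t) (λ u v → u ≡ s × v ≡ t) (λ _ → [])

arcG-wellFormed : ∀ s t → WellFormed (arcG s t)
arcG-wellFormed s t = record
  { V?        = λ v → v ≟ s ⊎-dec v ≟ t
  ; E⇒V       = λ { (refl , refl) → inj₁ refl , inj₂ refl }
  ; L-outside = λ _ → refl }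

-- Both maps are constrained because a root need not be a vertex (as for ε).
Pairs : ∀ {G H} → G ≅ H → Label → Label → Set
Pairs i r r′ = _≅_.f i r ≡ r′ × _≅_.g i r′ ≡ r

≅-byIdentity : ∀ {G H} → (∀ {v} → V G v → V H v) → (∀ {v} → V H v → V G v) →
               (∀ {u v} → E G u v → E H u v) → (∀ {u v} → E H u v → E G u v) →
               (∀ v → L G v ≡ L H v) → G ≅ H
≅-byIdentity V⇒ V⇐ E⇒ E⇐ L≡ = record
  { f = λ v → v ; g = λ v → v ; f-V = λ _ → V⇒ ; g-V = λ _ → V⇐
  ; gf = λ _ _ → refl ; fg = λ _ _ → refl
  ; E-pres = λ _ _ _ _ → E⇒ ; E-refl = λ _ _ _ _ → E⇐
  ; L-pres = λ v _ → ↭-reflexive (L≡ v) }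

≅-sym : ∀ {G H} → G ≅ H → H ≅ G
≅-sym {H = H} i = record
  { f = g ; g = f ; f-V = g-V ; g-V = f-V ; gf = fg ; fg = gf
  ; E-pres = λ u v hu hv e →
      E-refl (g u) (g v) (g-V u hu) (g-V v hv) (subst₂ (E H) (sym (fg u hu)) (sym (fg v hv)) e)
  ; E-refl = λ u v hu hv e →
      subst₂ (E H) (fg u hu) (fg v hv) (E-pres (g u) (g v) (g-V u hu) (g-V v hv) e)
  ; L-pres = λ v hv →
      ↭-trans (↭-reflexive (cong (L H) (sym (fg v hv)))) (↭-sym (L-pres (g v) (g-V v hv))) }
  where open _≅_ i

≅-trans : ∀ {G H K} → G ≅ H → H ≅ K → G ≅ K
≅-trans i j = record
  { f = J.f ∘ I.f ; g = I.g ∘ J.g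
  ; f-V = λ v hv → J.f-V _ (I.f-V v hv)
  ; g-V = λ w hw → I.g-V _ (J.g-V w hw)
  ; gf = λ v hv → trans (cong I.g (J.gf _ (I.f-V v hv))) (I.gf v hv)
  ; fg = λ w hw → trans (cong J.f (I.fg _ (J.g-V w hw))) (J.fg w hw)
  ; E-pres = λ u v hu hv e → J.E-pres _ _ (I.f-V u hu) (I.f-V v hv) (I.E-pres u v hu hv e)
  ; E-refl = λ u v hu hv e → I.E-refl u v hu hv (J.E-refl _ _ (I.f-V u hu) (I.f-V v hv) e)
  ; L-pres = λ v hv → ↭-trans (I.L-pres v hv) (J.L-pres _ (I.f-V v hv)) }
  where
  module I = _≅_ i
  module J = _≅_ j

emptyG-≅ : ∀ r r′ → Σ (emptyG ≅ emptyG) λ i → Pairs i r r′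
emptyG-≅ r r′ = record
  { f = λ _ → r′ ; g = λ _ → r ; f-V = λ _ () ; g-V = λ _ () ; gf = λ _ () ; fg = λ _ ()
  ; E-pres = λ _ _ () ; E-refl = λ _ _ () ; L-pres = λ _ () } , refl , refl

singleG-L-root : ∀ x A → L (singleG x A) x ≡ A ∷ []
singleG-L-root x A with x ≟ x
... | yes _   = refl
... | no x≢x  = ⊥-elim (x≢x refl)

singleG-≅ : ∀ r r′ A → Σ (singleG r A ≅ singleG r′ A) λ i → Pairs i r r′
singleG-≅ r r′ A = record
  { f = λ _ → r′ ; g = λ _ → r ; f-V = λ _ _ → refl ; g-V = λ _ _ → refl
  ; gf = λ _ → sym ; fg = λ _ → sym
  ; E-pres = λ _ _ _ _ () ; E-refl = λ _ _ _ _ ()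
  ; L-pres = λ { _ refl → ↭-reflexive (trans (singleG-L-root r A) (sym (singleG-L-root r′ A))) } }
  , refl , refl

arcG-≅ : ∀ {s t s′ t′} → s ≢ t → s′ ≢ t′ →
         Σ (arcG s t ≅ arcG s′ t′) λ i → Pairs i s s′ × Pairs i t t′
arcG-≅ {s} {t} {s′} {t′} s≢t s′≢t′ = iso , (fs , gs′) , (ft , gt′)
  where
  f : Label → Label
  f v = if does (v ≟ s) then s′ else t′
  g : Label → Label
  g w = if does (w ≟ s′) then s else t

  fs : f s ≡ s′
  fs = if-does (s ≟ s) (λ _ → refl) (λ s≢s → ⊥-elim (s≢s refl))
  ft : f t ≡ t′
  ft = if-does (t ≟ s) (λ t≡s → ⊥-elim (s≢t (sym t≡s))) (λ _ → refl)
  gs′ : g s′ ≡ s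
  gs′ = if-does (s′ ≟ s′) (λ _ → refl) (λ s′≢s′ → ⊥-elim (s′≢s′ refl))
  gt′ : g t′ ≡ t
  gt′ = if-does (t′ ≟ s′) (λ t′≡s′ → ⊥-elim (s′≢t′ (sym t′≡s′))) (λ _ → refl)

  source : ∀ {u} → u ≡ s ⊎ u ≡ t → f u ≡ s′ → u ≡ s
  source (inj₁ u≡s)  _   = u≡s
  source (inj₂ refl) fu = ⊥-elim (s′≢t′ (trans (sym fu) ft))
  target : ∀ {u} → u ≡ s ⊎ u ≡ t → f u ≡ t′ → u ≡ t
  target (inj₁ refl) fu = ⊥-elim (s′≢t′ (trans (sym fs) fu))
  target (inj₂ u≡t)  _  = u≡t

  iso : arcG s t ≅ arcG s′ t′
  iso = record
    { f = f ; g = g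
    ; f-V = λ { _ (inj₁ refl) → inj₁ fs ; _ (inj₂ refl) → inj₂ ft }
    ; g-V = λ { _ (inj₁ refl) → inj₁ gs′ ; _ (inj₂ refl) → inj₂ gt′ }
    ; gf = λ { _ (inj₁ refl) → trans (cong g fs) gs′ ; _ (inj₂ refl) → trans (cong g ft) gt′ }
    ; fg = λ { _ (inj₁ refl) → trans (cong f gs′) fs ; _ (inj₂ refl) → trans (cong f gt′) ft }
    ; E-pres = λ { _ _ _ _ (refl , refl) → fs , ft }
    ; E-refl = λ _ _ hu hv (fu , fv) → source hu fu , target hv fv
    ; L-pres = λ _ _ → ↭-refl }

module OnPiece {C C′ : LGraph} (wfC : WellFormed C) (wfC′ : WellFormed C′) (k : C ≅ C′)
               {φ ψ : Label → Label}
               (φ-on : ∀ {v} → V C v → φ v ≡ _≅_.f k v)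
               (ψ-on : ∀ {w} → V C′ w → ψ w ≡ _≅_.g k w) where
  open _≅_ k

  φ-V : ∀ {v} → V C v → V C′ (φ v)
  φ-V c = subst (V C′) (sym (φ-on c)) (f-V _ c)

  ψ-V : ∀ {w} → V C′ w → V C (ψ w)
  ψ-V c′ = subst (V C) (sym (ψ-on c′)) (g-V _ c′)

  ψφ : ∀ {v} → V C v → ψ (φ v) ≡ v
  ψφ c = trans (ψ-on (φ-V c)) (trans (cong g (φ-on c)) (gf _ c))

  φψ : ∀ {w} → V C′ w → φ (ψ w) ≡ w
  φψ c′ = trans (φ-on (ψ-V c′)) (trans (cong f (ψ-on c′)) (fg _ c′))

  reflect : ∀ {v} → ψ (φ v) ≡ v → V C′ (φ v) → V C v
  reflect ψφv c′ = subst (V C) ψφv (ψ-V c′)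

  E-pres-on : ∀ {u v} → E C u v → E C′ (φ u) (φ v)
  E-pres-on e with E⇒V wfC e
  ... | cu , cv = subst₂ (E C′) (sym (φ-on cu)) (sym (φ-on cv)) (E-pres _ _ cu cv e)

  E-refl-on : ∀ {u v} → ψ (φ u) ≡ u → ψ (φ v) ≡ v → E C′ (φ u) (φ v) → E C u v
  E-refl-on ψφu ψφv e with E⇒V wfC′ e
  ... | cu′ , cv′ = E-refl _ _ cu cv (subst₂ (E C′) (φ-on cu) (φ-on cv) e)
    where
    cu = reflect ψφu cu′
    cv = reflect ψφv cv′

  L-on : ∀ {v} → ψ (φ v) ≡ v → L C v ↭ L C′ (φ v)
  L-on {v} ψφv with V? wfC v
  ... | yes c  = subst (λ w → L C v ↭ L C′ w) (sym (φ-on c)) (L-pres v c)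
  ... | no ¬c  = ↭-reflexive (trans (L-outside wfC ¬c) (sym (L-outside wfC′ (¬c ∘ reflect ψφv))))

module UnionIso {A B A′ B′ : LGraph} {r r′ : Label}
                (wfA : WellFormed A) (wfB : WellFormed B) (wfA′ : WellFormed A′) (wfB′ : WellFormed B′)
                (A∩B⊆r : ∀ {v} → V A v → V B v → v ≡ r) (A′∩B′⊆r′ : ∀ {w} → V A′ w → V B′ w → w ≡ r′)
                (i : A ≅ A′) (j : B ≅ B′) (i-r : Pairs i r r′) (j-r : Pairs j r r′) where
  module I = _≅_ i
  module J = _≅_ j

  φ : Label → Label
  φ v = if does (V? wfA v) then I.f v else J.f v

  ψ : Label → Label
  ψ w = if does (V? wfA′ w) then I.g w else J.g w

  φ-onA : ∀ {v} → V A v → φ v ≡ I.f v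
  φ-onA a = if-does (V? wfA _) (λ _ → refl) (λ ¬a → ⊥-elim (¬a a))

  ψ-onA′ : ∀ {w} → V A′ w → ψ w ≡ I.g w
  ψ-onA′ a′ = if-does (V? wfA′ _) (λ _ → refl) (λ ¬a′ → ⊥-elim (¬a′ a′))

  φ-onB : ∀ {v} → V B v → φ v ≡ J.f v
  φ-onB b = if-does (V? wfA _) (λ a → subst (λ u → I.f u ≡ J.f u) (sym (A∩B⊆r a b))
                                             (trans (proj₁ i-r) (sym (proj₁ j-r))))
                               (λ _ → refl)

  ψ-onB′ : ∀ {w} → V B′ w → ψ w ≡ J.g w
  ψ-onB′ b′ = if-does (V? wfA′ _) (λ a′ → subst (λ u → I.g u ≡ J.g u) (sym (A′∩B′⊆r′ a′ b′))
                                                 (trans (proj₂ i-r) (sym (proj₂ j-r))))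
                                  (λ _ → refl)

  module OA = OnPiece wfA wfA′ i φ-onA ψ-onA′
  module OB = OnPiece wfB wfB′ j φ-onB ψ-onB′

  ψφ : ∀ v → V (unionG A B) v → ψ (φ v) ≡ v
  ψφ _ (inj₁ a) = OA.ψφ a
  ψφ _ (inj₂ b) = OB.ψφ b

  iso : unionG A B ≅ unionG A′ B′
  iso = record
    { f = φ ; g = ψ
    ; f-V = λ { _ (inj₁ a) → inj₁ (OA.φ-V a) ; _ (inj₂ b) → inj₂ (OB.φ-V b) }
    ; g-V = λ { _ (inj₁ a′) → inj₁ (OA.ψ-V a′) ; _ (inj₂ b′) → inj₂ (OB.ψ-V b′) }
    ; gf = ψφ
    ; fg = λ { _ (inj₁ a′) → OA.φψ a′ ; _ (inj₂ b′) → OB.φψ b′ }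
    ; E-pres = λ { _ _ _ _ (inj₁ e) → inj₁ (OA.E-pres-on e) ; _ _ _ _ (inj₂ e) → inj₂ (OB.E-pres-on e) }
    ; E-refl = λ { u v hu hv (inj₁ e) → inj₁ (OA.E-refl-on (ψφ u hu) (ψφ v hv) e)
                 ; u v hu hv (inj₂ e) → inj₂ (OB.E-refl-on (ψφ u hu) (ψφ v hv) e) }
    ; L-pres = λ v h → ++⁺ (OA.L-on (ψφ v h)) (OB.L-on (ψφ v h)) }

  iso-root : Pairs iso r r′
  iso-root = if-does (V? wfA r) (λ _ → proj₁ i-r) (λ _ → proj₁ j-r)
           , if-does (V? wfA′ r′) (λ _ → proj₂ i-r) (λ _ → proj₂ j-r)

  iso-inl : ∀ {s s′} → Pairs i s s′ → V A s → V A′ s′ → Pairs iso s s′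
  iso-inl (fs , gs′) a a′ = trans (φ-onA a) fs , trans (ψ-onA′ a′) gs′

addEdge-out-≅ : ∀ {K r y} → addEdge r y r y K ≅ unionG (arcG r y) K
addEdge-out-≅ = ≅-byIdentity swap swap swap swap (λ _ → refl)

addEdge-in-≅ : ∀ {K r y} → addEdge r y y r K ≅ unionG (arcG y r) K
addEdge-in-≅ = ≅-byIdentity (swap ∘ map₂ swap) (map₂ swap ∘ swap) swap swap (λ _ → refl)

Rep-unique : ∀ {r r′ X A A′} → Rep r X A → Rep r′ X A′ → Σ (A ≅ A′) λ i → Pairs i r r′
Rep-unique {r} {r′} rep-ε rep-ε = emptyG-≅ r r′
Rep-unique {r} {r′} (rep-fml {A = A}) rep-fml = singleG-≅ r r′ A
Rep-unique (rep-,, p₁ p₂ p₁∩p₂) (rep-,, q₁ q₂ q₁∩q₂) with Rep-unique p₁ q₁ | Rep-unique p₂ q₂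
... | i , i-r | j , j-r = U.iso , U.iso-root
  where
  module U = UnionIso (Rep⇒wellFormed p₁) (Rep⇒wellFormed p₂) (Rep⇒wellFormed q₁) (Rep⇒wellFormed q₂)
                      (p₁∩p₂ _) (q₁∩q₂ _) i j i-r j-r
Rep-unique {r} {r′} (rep-∘ {y = y} {G = K} p y≢r r∉K) (rep-∘ {y = y′} {G = K′} q y′≢r′ r′∉K′)
  with Rep-unique p q | arcG-≅ (y≢r ∘ sym) (y′≢r′ ∘ sym)
... | i , i-y | a , a-r , a-y =
  -- the identity isomorphisms around U.iso leave its vertex maps unchanged
  ≅-trans addEdge-out-≅ (≅-trans U.iso (≅-sym addEdge-out-≅)) ,
  U.iso-inl a-r (inj₁ refl) (inj₁ refl)
  where
  arc∩K⊆y : ∀ {v} → V (arcG r y) v → V K v → v ≡ y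
  arc∩K⊆y (inj₁ refl) K∋r = ⊥-elim (r∉K K∋r)
  arc∩K⊆y (inj₂ v≡y)  _   = v≡y
  arc∩K′⊆y′ : ∀ {w} → V (arcG r′ y′) w → V K′ w → w ≡ y′
  arc∩K′⊆y′ (inj₁ refl) K′∋r′ = ⊥-elim (r′∉K′ K′∋r′)
  arc∩K′⊆y′ (inj₂ w≡y′) _    = w≡y′
  module U = UnionIso (arcG-wellFormed r y) (Rep⇒wellFormed p) (arcG-wellFormed r′ y′) (Rep⇒wellFormed q)
                      arc∩K⊆y arc∩K′⊆y′ a i a-y i-y
Rep-unique {r} {r′} (rep-• {y = y} {G = K} p y≢r r∉K) (rep-• {y = y′} {G = K′} q y′≢r′ r′∉K′)
  with Rep-unique p q | arcG-≅ y≢r y′≢r′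
... | i , i-y | a , a-y , a-r =
  ≅-trans addEdge-in-≅ (≅-trans U.iso (≅-sym addEdge-in-≅)) ,
  U.iso-inl a-r (inj₂ refl) (inj₂ refl)
  where
  arc∩K⊆y : ∀ {v} → V (arcG y r) v → V K v → v ≡ y
  arc∩K⊆y (inj₁ v≡y)  _   = v≡y
  arc∩K⊆y (inj₂ refl) K∋r = ⊥-elim (r∉K K∋r)
  arc∩K′⊆y′ : ∀ {w} → V (arcG y′ r′) w → V K′ w → w ≡ y′
  arc∩K′⊆y′ (inj₁ w≡y′) _    = w≡y′
  arc∩K′⊆y′ (inj₂ refl) K′∋r′ = ⊥-elim (r′∉K′ K′∋r′)
  module U = UnionIso (arcG-wellFormed y r) (Rep⇒wellFormed p) (arcG-wellFormed y′ r′) (Rep⇒wellFormed q)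
                      arc∩K⊆y arc∩K′⊆y′ a i a-y i-y

unionG-shift-addEdge-≅ : ∀ {K₁ K₂ x z} → unionG K₁ (addEdge z x z x K₂) ≅ unionG (addEdge x z z x K₁) K₂
unionG-shift-addEdge-≅ = ≅-byIdentity
  (λ { (inj₁ k₁) → inj₁ (inj₁ k₁) ; (inj₂ (inj₁ k₂)) → inj₂ k₂
     ; (inj₂ (inj₂ (inj₁ v≡z))) → inj₁ (inj₂ (inj₂ v≡z)) ; (inj₂ (inj₂ (inj₂ v≡x))) → inj₁ (inj₂ (inj₁ v≡x)) })
  (λ { (inj₁ (inj₁ k₁)) → inj₁ k₁ ; (inj₂ k₂) → inj₂ (inj₁ k₂)
     ; (inj₁ (inj₂ (inj₁ v≡x))) → inj₂ (inj₂ (inj₂ v≡x)) ; (inj₁ (inj₂ (inj₂ v≡z))) → inj₂ (inj₂ (inj₁ v≡z)) })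
  (λ { (inj₁ e) → inj₁ (inj₁ e) ; (inj₂ (inj₁ e)) → inj₂ e ; (inj₂ (inj₂ e)) → inj₁ (inj₂ e) })
  (λ { (inj₁ (inj₁ e)) → inj₁ e ; (inj₂ e) → inj₂ (inj₁ e) ; (inj₁ (inj₂ e)) → inj₂ (inj₂ e) })
  (λ _ → refl)

lemma3p9 : ∀ (x : Label) (X Y : NSeq) (G H : LGraph) →
           Rep x (X ,, ∘[ Y ]) G → Rep x (•[ X ] ,, Y) H → G ≅ H
lemma3p9 x X Y G H repG (rep-,, {G₂ = H₂} (rep-• {y = z} {G = H₁} repX z≢x x∉H₁) repY H₀∩H₂⊆x) =
  ≅-trans (proj₁ (Rep-unique repG repH)) (unionG-shift-addEdge-≅ {H₁} {H₂})
  where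
  z∉H₂ : ¬ V H₂ z
  z∉H₂ H₂∋z = z≢x (H₀∩H₂⊆x z (inj₂ (inj₂ refl)) H₂∋z)

  H₁∩⊆z : ∀ v → V H₁ v → V (addEdge z x z x H₂) v → v ≡ z
  H₁∩⊆z v H₁∋v (inj₁ H₂∋v)        = ⊥-elim (x∉H₁ (subst (V H₁) (H₀∩H₂⊆x v (inj₁ H₁∋v) H₂∋v) H₁∋v))
  H₁∩⊆z v _    (inj₂ (inj₁ v≡z))  = v≡z
  H₁∩⊆z v H₁∋v (inj₂ (inj₂ refl)) = ⊥-elim (x∉H₁ H₁∋v)

  repH : Rep z (X ,, ∘[ Y ]) (unionG H₁ (addEdge z x z x H₂))
  repH = rep-,, repX (rep-∘ repY (z≢x ∘ sym) z∉H₂) H₁∩⊆z
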